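{- Let $\mathbf A$ be a semi-Heyting algebra. Then $\mathbf A$ is anti-Boolean if and only if $\mathbf A$ satisfies (i) $(x^*\to x)^*\approx1$ and (ii) $(x\to y)\vee(y\to z)\vee(z\to x)\approx1$.
   Context: A semi-Heyting algebra is an algebra $\langle A;\wedge,\vee,\to,0,1\rangle$ such that $\langle A;\wedge,\vee,0,1\rangle$ is a bounded lattice and the identities $x\wedge(x\to y)\approx x\wedge y$, $x\wedge(y\to z)\approx x\wedge((x\wedge y)\to(x\wedge z))$, $x\to x\approx1$ hold. Write $x^*:=x\to0$. $\bar{\mathbf 2}$ is the semi-Heyting algebra on the chain $0<1$ with $0\to0=1$, $0\to1=0$, $1\to0=0$, $1\to1=1$; a semi-Heyting algebra is anti-Boolean if it belongs to the variety generated by $\bar{\mathbf 2}$. -}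

module Defs where

open import Level using (Level; _⊔_) renaming (suc to lsuc; zero to lzero)
open import Data.Nat using (ℕ)
open import Data.Bool using (Bool; true; false)
import Data.Bool as B
open import Data.Bool.Properties using (∨-∧-isLattice)
open import Relation.Binary.Core using (Rel)
open import Relation.Binary.PropositionalEquality using (_≡_; refl; cong₂)
open import Algebra.Core using (Op₂)
open import Algebra.Lattice.Structures using (IsLattice)

infixr 5 _⇒ₜ_
infixr 6 _∨ₜ_
infixr 7 _∧ₜ_

record SemiHeytingAlgebra (c ℓ : Level) : Set (lsuc (c ⊔ ℓ)) where
  infixr 5 _⇒_
  infixr 6 _∨_
  infixr 7 _∧_
  infix 4 _≈_
  field
    Carrier   : Set c
    _≈_       : Rel Carrier ℓ
    _∧_       : Op₂ Carrier
    _∨_       : Op₂ Carrier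
    _⇒_       : Op₂ Carrier
    0#        : Carrier
    1#        : Carrier
    isLattice : IsLattice _≈_ _∨_ _∧_
    ⇒-cong    : ∀ {x x′ y y′} → x ≈ x′ → y ≈ y′ → (x ⇒ y) ≈ (x′ ⇒ y′)
    0-bottom  : ∀ x → 0# ∧ x ≈ 0#
    1-top     : ∀ x → 1# ∨ x ≈ 1#
    sh₁       : ∀ x y → x ∧ (x ⇒ y) ≈ x ∧ y
    sh₂       : ∀ x y z → x ∧ (y ⇒ z) ≈ x ∧ ((x ∧ y) ⇒ (x ∧ z))
    sh₃       : ∀ x → x ⇒ x ≈ 1#

  open IsLattice isLattice public

  _* : Carrier → Carrier
  x * = x ⇒ 0#

data Term : Set where
  var  : ℕ → Term
  _∧ₜ_ : Term → Term → Term
  _∨ₜ_ : Term → Term → Term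
  _⇒ₜ_ : Term → Term → Term
  0ₜ   : Term
  1ₜ   : Term

⟦_⟧ : ∀ {c ℓ} (t : Term) (A : SemiHeytingAlgebra c ℓ) →
      (ℕ → SemiHeytingAlgebra.Carrier A) → SemiHeytingAlgebra.Carrier A
⟦ var i ⟧ A ρ = ρ i
⟦ s ∧ₜ t ⟧ A ρ = SemiHeytingAlgebra._∧_ A (⟦ s ⟧ A ρ) (⟦ t ⟧ A ρ)
⟦ s ∨ₜ t ⟧ A ρ = SemiHeytingAlgebra._∨_ A (⟦ s ⟧ A ρ) (⟦ t ⟧ A ρ)
⟦ s ⇒ₜ t ⟧ A ρ = SemiHeytingAlgebra._⇒_ A (⟦ s ⟧ A ρ) (⟦ t ⟧ A ρ)
⟦ 0ₜ ⟧ A ρ = SemiHeytingAlgebra.0# A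
⟦ 1ₜ ⟧ A ρ = SemiHeytingAlgebra.1# A

_⊨_≈_ : ∀ {c ℓ} → SemiHeytingAlgebra c ℓ → Term → Term → Set (c ⊔ ℓ)
A ⊨ s ≈ t = ∀ (ρ : ℕ → SemiHeytingAlgebra.Carrier A) →
            SemiHeytingAlgebra._≈_ A (⟦ s ⟧ A ρ) (⟦ t ⟧ A ρ)

_⇒₂_ : Bool → Bool → Bool
false ⇒₂ false = true
false ⇒₂ true  = false
true  ⇒₂ false = false
true  ⇒₂ true  = true

2̄ : SemiHeytingAlgebra lzero lzero
2̄ = record
  { Carrier   = Bool
  ; _≈_       = _≡_
  ; _∧_       = B._∧_
  ; _∨_       = B._∨_
  ; _⇒_       = _⇒₂_
  ; 0#        = false
  ; 1#        = true
  ; isLattice = ∨-∧-isLattice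
  ; ⇒-cong    = cong₂ _⇒₂_
  ; 0-bottom  = λ _ → refl
  ; 1-top     = λ _ → refl
  ; sh₁       = sh₁
  ; sh₂       = sh₂
  ; sh₃       = sh₃
  }
  where
  sh₁ : ∀ x y → x B.∧ (x ⇒₂ y) ≡ x B.∧ y
  sh₁ false y     = refl
  sh₁ true false  = refl
  sh₁ true true   = refl
  sh₂ : ∀ x y z → x B.∧ (y ⇒₂ z) ≡ x B.∧ ((x B.∧ y) ⇒₂ (x B.∧ z))
  sh₂ false y z         = refl
  sh₂ true false false  = refl
  sh₂ true false true   = refl
  sh₂ true true false   = refl
  sh₂ true true true    = refl
  sh₃ : ∀ x → x ⇒₂ x ≡ true
  sh₃ false = refl
  sh₃ true  = refl

-- A is anti-Boolean iff A lies in the variety V(2̄) generated by 2̄, i.e.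
-- (Birkhoff) A satisfies every identity that holds in 2̄.
AntiBoolean : ∀ {c ℓ} → SemiHeytingAlgebra c ℓ → Set (c ⊔ ℓ)
AntiBoolean A = ∀ (s t : Term) → 2̄ ⊨ s ≈ t → A ⊨ s ≈ t

{-# OPTIONS --safe #-}
module Submission where

-- Both identities hold in 2̄, hence in every anti-Boolean algebra.  Conversely, (i) and
-- (ii) force 0 → 1 ≈ 0 and x ∨ x* ≈ 1.  The first makes {0, 1} a copy of 2̄ inside A.
-- By the second, x ≈ y as soon as x and y agree modulo both congruences θ(a, 1) and
-- θ(a*, 1), for any a; modulo θ(a, 1) a variable with value a may be set to 1, and
-- modulo θ(a*, 1) to 0.  Splitting on the finitely many variables of an identity in
-- turn thus reduces it to {0, 1}-valued assignments, where it holds because it holds in 2̄.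

open import Defs
open import Data.Bool using (Bool; true; false)
import Data.Bool as Bool
open import Data.Empty using (⊥-elim)
open import Data.Nat using (ℕ; zero; suc; _⊔_; _≟_)
open import Data.Product using (_×_; _,_)
open import Function.Base using (_∘_)
open import Function.Bundles using (_⇔_; mk⇔)
open import Relation.Nullary using (yes; no)
import Relation.Binary.PropositionalEquality as ≡
open import Algebra.Bundles using (CommutativeSemigroup)
open import Algebra.Lattice.Bundles using (Lattice)
open import Algebra.Structures using (module IsCommutativeBand)
import Algebra.Lattice.Properties.Lattice as LatticeProperties
import Algebra.Properties.CommutativeSemigroup as CommutativeSemigroupProperties
import Relation.Binary.Lattice as Order
import Relation.Binary.Lattice.Properties.BoundedLattice as BoundedLatticeProperties
import Relation.Binary.Lattice.Properties.BoundedJoinSemilattice as BoundedJoinSemilatticeProperties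
import Relation.Binary.Lattice.Properties.JoinSemilattice as JoinSemilatticeProperties
import Relation.Binary.Lattice.Properties.MeetSemilattice as MeetSemilatticeProperties
import Relation.Binary.Reasoning.PartialOrder as ≤-Reasoning

_[_≔_] : ∀ {a} {X : Set a} → (ℕ → X) → ℕ → X → ℕ → X
(ρ [ k ≔ v ]) i with i ≟ k
... | yes _ = v
... | no  _ = ρ i

arity : Term → ℕ
arity (var i)  = suc i
arity (s ∧ₜ t) = arity s ⊔ arity t
arity (s ∨ₜ t) = arity s ⊔ arity t
arity (s ⇒ₜ t) = arity s ⊔ arity t
arity 0ₜ       = 0
arity 1ₜ       = 0

module SemiHeytingAlgebraProperties {c ℓ} (A : SemiHeytingAlgebra c ℓ) where
  open SemiHeytingAlgebra A

  lattice : Lattice c ℓ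
  lattice = record { isLattice = isLattice }

  open LatticeProperties lattice public using (∧-idem)
  open LatticeProperties lattice using (∧-isSemilattice; ∨-∧-orderTheoreticLattice)

  ∧-identityʳ : ∀ x → x ∧ 1# ≈ x
  ∧-identityʳ x = trans (∧-congˡ (trans (sym (1-top x)) (∨-comm 1# x))) (∧-absorbs-∨ x 1#)

  ∧-identityˡ : ∀ x → 1# ∧ x ≈ x
  ∧-identityˡ x = trans (∧-comm 1# x) (∧-identityʳ x)

  boundedLattice : Order.BoundedLattice c ℓ ℓ
  boundedLattice = record
    { isBoundedLattice = record
      { isLattice = Order.Lattice.isLattice ∨-∧-orderTheoreticLattice
      ; maximum   = λ x → sym (∧-identityʳ x)
      ; minimum   = λ x → sym (0-bottom x)
      }
    }

  open Order.BoundedLattice boundedLattice public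
    using ( _≤_; setoid; poset; joinSemilattice; meetSemilattice; boundedJoinSemilattice
          ; antisym; maximum; x≤x∨y; y≤x∨y; ∨-least; x∧y≤x; x∧y≤y; ∧-greatest
          ; ≤-respˡ-≈; ≤-respʳ-≈ )
    renaming (refl to ≤-refl; trans to ≤-trans; reflexive to ≤-reflexive)
  open BoundedLatticeProperties boundedLattice public using (∧-zeroʳ)
  open BoundedJoinSemilatticeProperties boundedJoinSemilattice public using ()
    renaming (identityˡ to ∨-identityˡ; identityʳ to ∨-identityʳ)
  open JoinSemilatticeProperties joinSemilattice public using (∨-monotonic)
  open MeetSemilatticeProperties meetSemilattice public using (∧-monotonic)
  open ≤-Reasoning poset

  ∧-commutativeSemigroup : CommutativeSemigroup c ℓ
  ∧-commutativeSemigroup = record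
    { isCommutativeSemigroup = IsCommutativeBand.isCommutativeSemigroup ∧-isSemilattice }

  open CommutativeSemigroupProperties ∧-commutativeSemigroup using (interchange)

  ∧-distribˡ-∧ : ∀ a x y → a ∧ (x ∧ y) ≈ (a ∧ x) ∧ (a ∧ y)
  ∧-distribˡ-∧ a x y = trans (∧-congʳ (sym (∧-idem a))) (interchange a a x y)

  transpose-⇒ : ∀ {z x y} → z ∧ x ≤ y → z ≤ x ⇒ (x ∧ y)
  transpose-⇒ {z} {x} {y} zx≤y = sym (begin-equality
    z ∧ (x ⇒ (x ∧ y))             ≈⟨ sh₂ z x (x ∧ y) ⟩
    z ∧ ((z ∧ x) ⇒ (z ∧ (x ∧ y))) ≈⟨ ∧-congˡ (⇒-cong refl (∧-assoc z x y)) ⟨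
    z ∧ ((z ∧ x) ⇒ ((z ∧ x) ∧ y)) ≈⟨ ∧-congˡ (⇒-cong refl zx≤y) ⟨
    z ∧ ((z ∧ x) ⇒ (z ∧ x))       ≈⟨ ∧-congˡ (sh₃ (z ∧ x)) ⟩
    z ∧ 1#                        ≈⟨ ∧-identityʳ z ⟩
    z                             ∎)

  transpose-∧ : ∀ {z x y} → z ≤ x ⇒ (x ∧ y) → z ∧ x ≤ y
  transpose-∧ {z} {x} {y} z≤x⇒xy = begin
    z ∧ x              ≤⟨ ∧-greatest (x∧y≤y z x) (≤-trans (x∧y≤x z x) z≤x⇒xy) ⟩
    x ∧ (x ⇒ (x ∧ y))  ≈⟨ sh₁ x (x ∧ y) ⟩
    x ∧ (x ∧ y)        ≤⟨ x∧y≤y x (x ∧ y) ⟩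
    x ∧ y              ≤⟨ x∧y≤y x y ⟩
    y                  ∎

  -- x ∧ _ is left adjoint to x ⇒ (x ∧ _), so it preserves joins.
  ∧-distribˡ-∨ : ∀ x y z → x ∧ (y ∨ z) ≈ (x ∧ y) ∨ (x ∧ z)
  ∧-distribˡ-∨ x y z = antisym
    (≤-respˡ-≈ (∧-comm (y ∨ z) x) (transpose-∧ (∨-least (adjoint (x≤x∨y _ _)) (adjoint (y≤x∨y _ _)))))
    (∨-least (∧-monotonic ≤-refl (x≤x∨y y z)) (∧-monotonic ≤-refl (y≤x∨y y z)))
    where
    adjoint : ∀ {u} → x ∧ u ≤ x ∧ y ∨ x ∧ z → u ≤ x ⇒ (x ∧ (x ∧ y ∨ x ∧ z))
    adjoint xu≤w = transpose-⇒ (≤-respˡ-≈ (∧-comm _ _) xu≤w)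

  1⇒0≈0 : 1# ⇒ 0# ≈ 0#
  1⇒0≈0 = begin-equality
    1# ⇒ 0#         ≈⟨ ∧-identityˡ _ ⟨
    1# ∧ (1# ⇒ 0#)  ≈⟨ sh₁ 1# 0# ⟩
    1# ∧ 0#         ≈⟨ ∧-zeroʳ 1# ⟩
    0#              ∎

  x∧x*≈0 : ∀ x → x ∧ x * ≈ 0#
  x∧x*≈0 x = trans (sh₁ x 0#) (∧-zeroʳ x)

  x*≈1⇒x≈0 : ∀ {x} → x * ≈ 1# → x ≈ 0#
  x*≈1⇒x≈0 {x} x*≈1 = begin-equality
    x        ≈⟨ ∧-identityʳ x ⟨
    x ∧ 1#   ≈⟨ ∧-congˡ x*≈1 ⟨
    x ∧ x *  ≈⟨ x∧x*≈0 x ⟩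
    0#       ∎

  x∧y≈0⇒x≤y* : ∀ {x y} → x ∧ y ≈ 0# → x ≤ y *
  x∧y≈0⇒x≤y* {y = y} x∧y≈0 =
    ≤-respʳ-≈ (⇒-cong refl (∧-zeroʳ y)) (transpose-⇒ (≤-reflexive x∧y≈0))

  -- x ≈[ a ] y is the congruence θ(a, 1) collapsing the principal filter of a.
  infix 4 _≈[_]_
  _≈[_]_ : Carrier → Carrier → Carrier → Set ℓ
  x ≈[ a ] y = a ∧ x ≈ a ∧ y

  ∧-cong-≈[] : ∀ {a x x′ y y′} → x ≈[ a ] x′ → y ≈[ a ] y′ → x ∧ y ≈[ a ] x′ ∧ y′
  ∧-cong-≈[] {a} x≈x′ y≈y′ =
    trans (∧-distribˡ-∧ a _ _) (trans (∧-cong x≈x′ y≈y′) (sym (∧-distribˡ-∧ a _ _)))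

  ∨-cong-≈[] : ∀ {a x x′ y y′} → x ≈[ a ] x′ → y ≈[ a ] y′ → x ∨ y ≈[ a ] x′ ∨ y′
  ∨-cong-≈[] {a} x≈x′ y≈y′ =
    trans (∧-distribˡ-∨ a _ _) (trans (∨-cong x≈x′ y≈y′) (sym (∧-distribˡ-∨ a _ _)))

  ⇒-cong-≈[] : ∀ {a x x′ y y′} → x ≈[ a ] x′ → y ≈[ a ] y′ → (x ⇒ y) ≈[ a ] (x′ ⇒ y′)
  ⇒-cong-≈[] {a} x≈x′ y≈y′ =
    trans (sh₂ a _ _) (trans (∧-congˡ (⇒-cong x≈x′ y≈y′)) (sym (sh₂ a _ _)))

  ≈-by-cases : ∀ a {x y} → a ∨ a * ≈ 1# → x ≈[ a ] y → x ≈[ a * ] y → x ≈ y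
  ≈-by-cases a {x} {y} a∨a*≈1 x≈[a]y x≈[a*]y = begin-equality
    x                    ≈⟨ split x ⟩
    a ∧ x ∨ a * ∧ x      ≈⟨ ∨-cong x≈[a]y x≈[a*]y ⟩
    a ∧ y ∨ a * ∧ y      ≈⟨ split y ⟨
    y                    ∎
    where
    split : ∀ z → z ≈ a ∧ z ∨ a * ∧ z
    split z = begin-equality
      z                  ≈⟨ ∧-identityʳ z ⟨
      z ∧ 1#             ≈⟨ ∧-congˡ a∨a*≈1 ⟨
      z ∧ (a ∨ a *)      ≈⟨ ∧-distribˡ-∨ z a (a *) ⟩
      z ∧ a ∨ z ∧ a *    ≈⟨ ∨-cong (∧-comm z a) (∧-comm z (a *)) ⟩
      a ∧ z ∨ a * ∧ z    ∎

  x≈[x]1 : ∀ x → x ≈[ x ] 1#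
  x≈[x]1 x = trans (∧-idem x) (sym (∧-identityʳ x))

  x≈[x*]0 : ∀ x → x ≈[ x * ] 0#
  x≈[x*]0 x = trans (∧-comm (x *) x) (trans (x∧x*≈0 x) (sym (∧-zeroʳ (x *))))

module Semantics {c ℓ} (A : SemiHeytingAlgebra c ℓ) where
  open SemiHeytingAlgebra A
  open SemiHeytingAlgebraProperties A hiding (_≤_)
  open import Data.Nat using (_≤_; _<_)
  open import Data.Nat.Properties using (m⊔n≤o⇒m≤o; m⊔n≤o⇒n≤o)

  ⟦⟧-cong-below : ∀ t {N ρ σ} → arity t ≤ N → (∀ i → i < N → ρ i ≈ σ i) →
                  ⟦ t ⟧ A ρ ≈ ⟦ t ⟧ A σ
  ⟦⟧-cong-below (var i)  i<N ρ≈σ = ρ≈σ i i<N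
  ⟦⟧-cong-below (s ∧ₜ t) ≤N ρ≈σ =
    ∧-cong (⟦⟧-cong-below s (m⊔n≤o⇒m≤o _ _ ≤N) ρ≈σ) (⟦⟧-cong-below t (m⊔n≤o⇒n≤o _ _ ≤N) ρ≈σ)
  ⟦⟧-cong-below (s ∨ₜ t) ≤N ρ≈σ =
    ∨-cong (⟦⟧-cong-below s (m⊔n≤o⇒m≤o _ _ ≤N) ρ≈σ) (⟦⟧-cong-below t (m⊔n≤o⇒n≤o _ _ ≤N) ρ≈σ)
  ⟦⟧-cong-below (s ⇒ₜ t) ≤N ρ≈σ =
    ⇒-cong (⟦⟧-cong-below s (m⊔n≤o⇒m≤o _ _ ≤N) ρ≈σ) (⟦⟧-cong-below t (m⊔n≤o⇒n≤o _ _ ≤N) ρ≈σ)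
  ⟦⟧-cong-below 0ₜ       _   _   = refl
  ⟦⟧-cong-below 1ₜ       _   _   = refl

  ⟦⟧-cong-≈[] : ∀ t {a ρ σ} → (∀ i → ρ i ≈[ a ] σ i) → ⟦ t ⟧ A ρ ≈[ a ] ⟦ t ⟧ A σ
  ⟦⟧-cong-≈[] (var i)  ρ≈σ = ρ≈σ i
  ⟦⟧-cong-≈[] (s ∧ₜ t) ρ≈σ = ∧-cong-≈[] (⟦⟧-cong-≈[] s ρ≈σ) (⟦⟧-cong-≈[] t ρ≈σ)
  ⟦⟧-cong-≈[] (s ∨ₜ t) ρ≈σ = ∨-cong-≈[] (⟦⟧-cong-≈[] s ρ≈σ) (⟦⟧-cong-≈[] t ρ≈σ)
  ⟦⟧-cong-≈[] (s ⇒ₜ t) ρ≈σ = ⇒-cong-≈[] (⟦⟧-cong-≈[] s ρ≈σ) (⟦⟧-cong-≈[] t ρ≈σ)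
  ⟦⟧-cong-≈[] 0ₜ       _   = refl
  ⟦⟧-cong-≈[] 1ₜ       _   = refl

  update-≈[] : ∀ {a ρ k v} → ρ k ≈[ a ] v → ∀ i → ρ i ≈[ a ] (ρ [ k ≔ v ]) i
  update-≈[] {k = k} ρk≈v i with i ≟ k
  ... | yes ≡.refl = ρk≈v
  ... | no  _      = refl

  fromBool : Bool → Carrier
  fromBool true  = 1#
  fromBool false = 0#

  fromBool-∧ : ∀ a b → fromBool a ∧ fromBool b ≈ fromBool (a Bool.∧ b)
  fromBool-∧ true  b = ∧-identityˡ (fromBool b)
  fromBool-∧ false b = 0-bottom (fromBool b)

  fromBool-∨ : ∀ a b → fromBool a ∨ fromBool b ≈ fromBool (a Bool.∨ b)
  fromBool-∨ true  b = 1-top (fromBool b)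
  fromBool-∨ false b = ∨-identityˡ (fromBool b)

  module _ (0⇒1≈0 : 0# ⇒ 1# ≈ 0#) where

    fromBool-⇒ : ∀ a b → fromBool a ⇒ fromBool b ≈ fromBool (a ⇒₂ b)
    fromBool-⇒ true  true  = sh₃ 1#
    fromBool-⇒ true  false = 1⇒0≈0
    fromBool-⇒ false true  = 0⇒1≈0
    fromBool-⇒ false false = sh₃ 0#

    ⟦⟧-fromBool : ∀ t β → ⟦ t ⟧ A (fromBool ∘ β) ≈ fromBool (⟦ t ⟧ 2̄ β)
    ⟦⟧-fromBool (var i)  β = refl
    ⟦⟧-fromBool (s ∧ₜ t) β =
      trans (∧-cong (⟦⟧-fromBool s β) (⟦⟧-fromBool t β)) (fromBool-∧ (⟦ s ⟧ 2̄ β) (⟦ t ⟧ 2̄ β))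
    ⟦⟧-fromBool (s ∨ₜ t) β =
      trans (∨-cong (⟦⟧-fromBool s β) (⟦⟧-fromBool t β)) (fromBool-∨ (⟦ s ⟧ 2̄ β) (⟦ t ⟧ 2̄ β))
    ⟦⟧-fromBool (s ⇒ₜ t) β =
      trans (⇒-cong (⟦⟧-fromBool s β) (⟦⟧-fromBool t β)) (fromBool-⇒ (⟦ s ⟧ 2̄ β) (⟦ t ⟧ 2̄ β))
    ⟦⟧-fromBool 0ₜ       β = refl
    ⟦⟧-fromBool 1ₜ       β = refl

module Complemented {c ℓ} (A : SemiHeytingAlgebra c ℓ) where
  open SemiHeytingAlgebra A
  open SemiHeytingAlgebraProperties A hiding (_≤_)
  open Semantics A
  open import Data.Nat using (_≤_; _<_; z≤n)
  open import Data.Nat.Properties using (<⇒≱; ≤∧≢⇒<; m≤m⊔n; m≤n⊔m)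
  open import Relation.Binary.Reasoning.Setoid setoid

  module _ (0⇒1≈0 : 0# ⇒ 1# ≈ 0#) (x∨x*≈1 : ∀ x → x ∨ x * ≈ 1#) where

    ≈-when-Boolean-from : ∀ s t → 2̄ ⊨ s ≈ t → ∀ k (σ : ℕ → Carrier) (β : ℕ → Bool) →
                          (∀ i → k ≤ i → i < arity s ⊔ arity t → σ i ≈ fromBool (β i)) →
                          ⟦ s ⟧ A σ ≈ ⟦ t ⟧ A σ
    ≈-when-Boolean-from s t 2̄⊨s≈t zero σ β σ≈β = begin
      ⟦ s ⟧ A σ               ≈⟨ ⟦⟧-cong-below s (m≤m⊔n _ _) (λ i → σ≈β i z≤n) ⟩
      ⟦ s ⟧ A (fromBool ∘ β)  ≈⟨ ⟦⟧-fromBool 0⇒1≈0 s β ⟩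
      fromBool (⟦ s ⟧ 2̄ β)    ≈⟨ reflexive (≡.cong fromBool (2̄⊨s≈t β)) ⟩
      fromBool (⟦ t ⟧ 2̄ β)    ≈⟨ ⟦⟧-fromBool 0⇒1≈0 t β ⟨
      ⟦ t ⟧ A (fromBool ∘ β)  ≈⟨ ⟦⟧-cong-below t (m≤n⊔m _ _) (λ i → σ≈β i z≤n) ⟨
      ⟦ t ⟧ A σ               ∎
    ≈-when-Boolean-from s t 2̄⊨s≈t (suc k) σ β σ≈β =
      ≈-by-cases (σ k) (x∨x*≈1 (σ k)) (modulo true (x≈[x]1 (σ k))) (modulo false (x≈[x*]0 (σ k)))
      where
      modulo : ∀ {a} b → σ k ≈[ a ] fromBool b → ⟦ s ⟧ A σ ≈[ a ] ⟦ t ⟧ A σ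
      modulo {a} b σk≈b = begin
        a ∧ ⟦ s ⟧ A σ   ≈⟨ ⟦⟧-cong-≈[] s (update-≈[] σk≈b) ⟩
        a ∧ ⟦ s ⟧ A σ′  ≈⟨ ∧-congˡ (≈-when-Boolean-from s t 2̄⊨s≈t k σ′ (β [ k ≔ b ]) σ′≈β′) ⟩
        a ∧ ⟦ t ⟧ A σ′  ≈⟨ ⟦⟧-cong-≈[] t (update-≈[] σk≈b) ⟨
        a ∧ ⟦ t ⟧ A σ   ∎
        where
        σ′ : ℕ → Carrier
        σ′ = σ [ k ≔ fromBool b ]
        σ′≈β′ : ∀ i → k ≤ i → i < arity s ⊔ arity t → σ′ i ≈ fromBool ((β [ k ≔ b ]) i)
        σ′≈β′ i k≤i i<N with i ≟ k
        ... | yes _  = refl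
        ... | no i≢k = σ≈β i (≤∧≢⇒< k≤i (i≢k ∘ ≡.sym)) i<N

    antiBoolean : AntiBoolean A
    antiBoolean s t 2̄⊨s≈t ρ = ≈-when-Boolean-from s t 2̄⊨s≈t (arity s ⊔ arity t) ρ (λ _ → false)
      (λ i N≤i i<N → ⊥-elim (<⇒≱ i<N N≤i))

module Identities {c ℓ} (A : SemiHeytingAlgebra c ℓ) where
  open SemiHeytingAlgebra A
  open SemiHeytingAlgebraProperties A
  open ≤-Reasoning poset

  module _ (identity-i  : ∀ x → (((x *) ⇒ x) *) ≈ 1#)
           (identity-ii : ∀ x y z → ((x ⇒ y) ∨ (y ⇒ z) ∨ (z ⇒ x)) ≈ 1#) where

    0⇒1≈0 : 0# ⇒ 1# ≈ 0#
    0⇒1≈0 = x*≈1⇒x≈0 (trans (⇒-cong (⇒-cong (sym 1⇒0≈0) refl) refl) (identity-i 1#))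

    x*⇒x≈0 : ∀ x → (x *) ⇒ x ≈ 0#
    x*⇒x≈0 x = x*≈1⇒x≈0 (identity-i x)

    x∧[0⇒x]≈0 : ∀ x → x ∧ (0# ⇒ x) ≈ 0#
    x∧[0⇒x]≈0 x = begin-equality
      x ∧ (0# ⇒ x)               ≈⟨ sh₂ x 0# x ⟩
      x ∧ ((x ∧ 0#) ⇒ (x ∧ x))   ≈⟨ ∧-congˡ (⇒-cong refl (x≈[x]1 x)) ⟩
      x ∧ ((x ∧ 0#) ⇒ (x ∧ 1#))  ≈⟨ sh₂ x 0# 1# ⟨
      x ∧ (0# ⇒ 1#)              ≈⟨ ∧-congˡ 0⇒1≈0 ⟩
      x ∧ 0#                     ≈⟨ ∧-zeroʳ x ⟩
      0#                         ∎

    x**≤x : ∀ x → x * * ≤ x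
    x**≤x x = begin
      e                                      ≈⟨ ∧-identityʳ e ⟨
      e ∧ 1#                                 ≈⟨ ∧-congˡ (identity-ii 0# e x) ⟨
      e ∧ ((0# ⇒ e) ∨ (e ⇒ x) ∨ x *)         ≈⟨ ∧-distribˡ-∨ _ _ _ ⟩
      e ∧ (0# ⇒ e) ∨ e ∧ ((e ⇒ x) ∨ x *)     ≈⟨ ∨-cong (x∧[0⇒x]≈0 e) (∧-distribˡ-∨ _ _ _) ⟩
      0# ∨ e ∧ (e ⇒ x) ∨ e ∧ x *             ≈⟨ ∨-identityˡ _ ⟩
      e ∧ (e ⇒ x) ∨ e ∧ x *                  ≈⟨ ∨-cong (sh₁ e x) (trans (∧-comm e (x *)) (x∧x*≈0 (x *))) ⟩
      e ∧ x ∨ 0#                             ≈⟨ ∨-identityʳ _ ⟩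
      e ∧ x                                  ≤⟨ x∧y≤y e x ⟩
      x                                      ∎
      where
      e : Carrier
      e = x * *

    x∨x*≈1 : ∀ x → x ∨ x * ≈ 1#
    x∨x*≈1 x = antisym (maximum _) (begin
      1#                               ≈⟨ identity-ii x 0# (x *) ⟨
      x * ∨ (0# ⇒ x *) ∨ ((x *) ⇒ x)   ≈⟨ ∨-congˡ (∨-congˡ (x*⇒x≈0 x)) ⟩
      x * ∨ (0# ⇒ x *) ∨ 0#            ≈⟨ ∨-congˡ (∨-identityʳ _) ⟩
      x * ∨ (0# ⇒ x *)                 ≤⟨ ∨-monotonic ≤-refl 0⇒x*≤x ⟩
      x * ∨ x                          ≈⟨ ∨-comm (x *) x ⟩
      x ∨ x *                          ∎)
      where
      0⇒x*≤x : 0# ⇒ x * ≤ x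
      0⇒x*≤x = ≤-trans (x∧y≈0⇒x≤y* (trans (∧-comm _ _) (x∧[0⇒x]≈0 (x *)))) (x**≤x x)

identity-iₜ : Term
identity-iₜ = ((x ⇒ₜ 0ₜ) ⇒ₜ x) ⇒ₜ 0ₜ
  where x = var 0

identity-iiₜ : Term
identity-iiₜ = (x ⇒ₜ y) ∨ₜ (y ⇒ₜ z) ∨ₜ (z ⇒ₜ x)
  where x = var 0; y = var 1; z = var 2

2̄⊨identity-i : 2̄ ⊨ identity-iₜ ≈ 1ₜ
2̄⊨identity-i β with β 0
... | false = ≡.refl
... | true  = ≡.refl

2̄⊨identity-ii : 2̄ ⊨ identity-iiₜ ≈ 1ₜ
2̄⊨identity-ii β with β 0 | β 1 | β 2
... | true  | true  | _     = ≡.refl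
... | true  | false | true  = ≡.refl
... | true  | false | false = ≡.refl
... | false | true  | true  = ≡.refl
... | false | true  | false = ≡.refl
... | false | false | true  = ≡.refl
... | false | false | false = ≡.refl

theorem7p5 : ∀ {c ℓ} (A : SemiHeytingAlgebra c ℓ) → let open SemiHeytingAlgebra A in
    AntiBoolean A ⇔ ((∀ x → (((x *) ⇒ x) *) ≈ 1#) × (∀ x y z → ((x ⇒ y) ∨ (y ⇒ z) ∨ (z ⇒ x)) ≈ 1#))
theorem7p5 A = mk⇔
  (λ A-antiBoolean →
      (λ x → A-antiBoolean identity-iₜ 1ₜ 2̄⊨identity-i (λ _ → x))
    , (λ x y z → A-antiBoolean identity-iiₜ 1ₜ 2̄⊨identity-ii λ { 0 → x ; 1 → y ; _ → z }))
  (λ (i , ii) → Complemented.antiBoolean A (Identities.0⇒1≈0 A i ii) (Identities.x∨x*≈1 A i ii))
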